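{- For every $n\ge 2$ and every $i\in[2n+2]$, the simple trunk $\mathrm{Tk}_{\mathcal C_n}(i)=\{c\in\mathcal C_n\mid i\in c\}$, regarded as a code in $2^{[2n+2]}$, is convex.
   Context: A code is a subset $\mathcal C\subseteq 2^{[N]}$. Given convex open sets $U_1,\ldots,U_N$ contained in a convex open set $X\subseteq\mathbb R^d$, their code is $\{\sigma\subseteq[N]\mid \bigcap_{i\in\sigma}U_i\setminus\bigcup_{j\notin\sigma}U_j\neq\emptyset\}$, where the empty intersection is $X$. A code is convex if it equals the code of some such collection in some $\mathbb R^d$. For $n\ge2$, $\mathcal C_n\subseteq 2^{[2n+2]}$ is the code consisting of: (i) $\emptyset$; (ii) $\sigma\cup\{n+1\}$ for every nonempty proper subset $\sigma\subsetneq[n]$; (iii) $\{n+1+i\}$ for $1\le i\le n+1$; (iv) $([n]\setminus\{i\})\cup\{n+1\}\cup\{n+1+i\}$ for $1\le i\le n$; (v) $[n]\cup\{n+1\}\cup\{2n+2\}$; (vi) $\{n+2,n+3,\ldots,2n+2\}$. -}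

module Defs where

open import Level using (Level; 0ℓ)
open import Data.Nat as ℕ using (ℕ; zero; suc; _∸_)
open import Data.Bool using (Bool; true; false; _∧_; _∨_; not)
open import Data.Fin using (Fin; toℕ)
open import Data.Fin.Subset using (Subset; _∈_; _∉_)
open import Data.Vec using (Vec; lookup; zipWith; map)
open import Data.Product using (Σ; _×_; _,_; ∃; ∃-syntax)
open import Data.Sum using (_⊎_)
open import Relation.Nullary using (¬_)
open import Relation.Binary.PropositionalEquality using (_≡_)
open import Algebra.Structures using (IsCommutativeRing)
open import Relation.Binary.Structures using (IsStrictTotalOrder)

-- The real numbers, axiomatised as a complete ordered field.
-- (agda-stdlib has no reals; we quantify over every model of the axioms.)

record RealField : Set₁ where
  infixl 6 _+_
  infixl 7 _*_
  infix 4 _<_ _≤_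
  field
    ℝ   : Set
    _+_ : ℝ → ℝ → ℝ
    _*_ : ℝ → ℝ → ℝ
    -_  : ℝ → ℝ
    0# 1# : ℝ
    _<_ : ℝ → ℝ → Set
    isCommutativeRing : IsCommutativeRing _≡_ _+_ _*_ -_ 0# 1#
    0≢1 : ¬ (0# ≡ 1#)
    inverse : ∀ x → ¬ (x ≡ 0#) → Σ ℝ (λ y → x * y ≡ 1#)
    isStrictTotalOrder : IsStrictTotalOrder _≡_ _<_
    +-mono-< : ∀ x y z → x < y → x + z < y + z
    *-pos : ∀ x y → 0# < x → 0# < y → 0# < x * y

  _≤_ : ℝ → ℝ → Set
  x ≤ y = (x < y) ⊎ (x ≡ y)

  IsUpperBound : (ℝ → Set) → ℝ → Set
  IsUpperBound S b = ∀ x → S x → x ≤ b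

  field
    completeness : (S : ℝ → Set) → Σ ℝ S → Σ ℝ (IsUpperBound S) →
                   Σ ℝ (λ s → IsUpperBound S s × (∀ b → IsUpperBound S b → s ≤ b))

-- A code on [N] is a set of codewords σ ⊆ [N]; codewords are 'Subset N'
-- (Fin N is [N] shifted down by one), and a code is a predicate on them.
Code : ℕ → Set₁
Code N = Subset N → Set

module Geometry (R : RealField) where
  open RealField R

  Point : ℕ → Set
  Point d = Vec ℝ d

  segment : ∀ {d} → ℝ → Point d → Point d → Point d
  segment t p q = zipWith _+_ (map (t *_) p) (map ((1# + - t) *_) q)

  IsConvex : ∀ {d} → (Point d → Set) → Set
  IsConvex S = ∀ p q t → S p → S q → 0# ≤ t → t ≤ 1# → S (segment t p q)

  -- open in the Euclidean topology (equivalently, open sup-norm boxes)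
  IsOpen : ∀ {d} → (Point d → Set) → Set
  IsOpen {d} S = ∀ p → S p → Σ ℝ λ ε → (0# < ε) ×
    (∀ q → (∀ (k : Fin d) → (- ε < lookup q k + - lookup p k)
                           × (lookup q k + - lookup p k < ε)) → S q)

  Realised : ∀ {d N} → (Point d → Set) → (Fin N → Point d → Set) → Subset N → Set
  Realised X U σ = Σ _ λ p → X p × (∀ i → i ∈ σ → U i p) × (∀ j → j ∉ σ → ¬ U j p)

  IsConvexRealisation : ∀ {N} (C : Code N) (d : ℕ) (X : Point d → Set) (U : Fin N → Point d → Set) → Set
  IsConvexRealisation C d X U =
      IsConvex X × IsOpen X
    × (∀ i → IsConvex (U i) × IsOpen (U i) × (∀ p → U i p → X p))
    × (∀ σ → (C σ → Realised X U σ) × (Realised X U σ → C σ))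

IsConvexCode : RealField → ∀ {N} → Code N → Set₁
IsConvexCode R {N} C =
  Σ ℕ λ d → Σ (Geometry.Point R d → Set) λ X → Σ (Fin N → Geometry.Point R d → Set) λ U →
    Geometry.IsConvexRealisation R C d X U

-- The code 𝒞ₙ ⊆ 2^[2n+2].  We use 1-based labels: element x : Fin N has
-- label toℕ x + 1 ∈ [N].  σ ≐ f means: σ = { x | f (label x) ≡ true }.

label : ∀ {N} → Fin N → ℕ
label x = suc (toℕ x)

_≐_ : ∀ {N} → Subset N → (ℕ → Bool) → Set
σ ≐ f = ∀ x → lookup σ x ≡ f (label x)

inRange : ℕ → ℕ → Bool
inRange m k = (1 ℕ.≤ᵇ k) ∧ (k ℕ.≤ᵇ m)

data 𝒞 (n : ℕ) : Code (n ℕ.+ n ℕ.+ 2) where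
  c-empty : ∀ {σ} → σ ≐ (λ _ → false) → 𝒞 n σ
  -- (ii) τ ∪ {n+1} for nonempty proper τ ⊊ [n]  (τ given by its indicator P on [n])
  c-trunk : ∀ {σ} (P : ℕ → Bool) →
            Σ ℕ (λ k → (inRange n k ≡ true) × (P k ≡ true)) →
            Σ ℕ (λ k → (inRange n k ≡ true) × (P k ≡ false)) →
            σ ≐ (λ k → (inRange n k ∧ P k) ∨ (k ℕ.≡ᵇ suc n)) → 𝒞 n σ
  c-single : ∀ {σ} (i : ℕ) → inRange (suc n) i ≡ true →
             σ ≐ (λ k → k ℕ.≡ᵇ suc n ℕ.+ i) → 𝒞 n σ
  c-miss : ∀ {σ} (i : ℕ) → inRange n i ≡ true →
           σ ≐ (λ k → (inRange n k ∧ not (k ℕ.≡ᵇ i)) ∨ (k ℕ.≡ᵇ suc n) ∨ (k ℕ.≡ᵇ suc n ℕ.+ i)) → 𝒞 n σ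
  c-full : ∀ {σ} → σ ≐ (λ k → inRange (suc n) k ∨ (k ℕ.≡ᵇ n ℕ.+ n ℕ.+ 2)) → 𝒞 n σ
  c-top : ∀ {σ} → σ ≐ (λ k → (suc (suc n) ℕ.≤ᵇ k) ∧ (k ℕ.≤ᵇ n ℕ.+ n ℕ.+ 2)) → 𝒞 n σ

Tk : (n : ℕ) → Fin (n ℕ.+ n ℕ.+ 2) → Code (n ℕ.+ n ℕ.+ 2)
Tk n i σ = 𝒞 n σ × (i ∈ σ)

module Submission where

-- Write c = n + 1. Every codeword through a label k ≤ n also passes through c, so Tk(k) is the
-- simple trunk at k of Tk(c), and simple trunks of convex codes are convex (cut all sets down to
-- U_k). It remains to realise Tk(c) and the trunks at c + j for 1 ≤ j ≤ n + 1.
--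
-- Tk(c) lives in X = {x₀ < xₙ} ⊆ ℝⁿ⁺¹: label k ≤ n is the ascent x_{k-1} < x_k, label c + j
-- (j ≤ n) is "a descent at step j and ascents at all other steps", label 2n+2 is "ascents at all
-- steps", and U_c = X. A point of X with all ascents shows [n] ∪ {c, 2n+2}; one whose only
-- non-ascent is a descent at j shows ([n] ∖ {j}) ∪ {c, c+j}; any other point shows τ ∪ {c} for
-- its set τ of ascents, which is proper, and nonempty because x₀ < xₙ.
--
-- The trunk at c + j has just three codewords, A ∋ c + j, {c + j} and B = {n+2, …, 2n+2}, with
-- A ∩ B = {c + j}; they are realised in ℝ² above, on, and below the diagonal.

open import Defs
open import Algebra.Bundles using (CommutativeRing)
import Algebra.Properties.CommutativeSemigroup as CommutativeSemigroupProperties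
import Algebra.Properties.Ring as RingProperties
open import Data.Bool using (Bool; true; false; not; _∧_; _∨_; if_then_else_)
open import Data.Bool.Properties using (∨-zeroʳ; ∨-identityʳ; ∧-zeroʳ; T-≡)
open import Data.Empty using (⊥; ⊥-elim)
open import Data.Fin as Fin using (Fin; toℕ; fromℕ<)
import Data.Fin.Properties as Finₚ
open import Data.Fin.Properties using (all?; any?; ¬∀⟶∃¬)
open import Data.Fin.Subset using (Subset; _∈_; _∉_)
open import Data.Fin.Subset.Properties using (_∈?_)
open import Data.Nat as ℕ using (ℕ; zero; suc; pred; _≡ᵇ_; _≤ᵇ_; z≤n; s≤s)
import Data.Nat.Properties as ℕₚ
open import Data.Product using (Σ; _×_; _,_; proj₁; proj₂; map)
open import Data.Sum using (_⊎_; inj₁; inj₂)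
open import Data.Unit using (⊤; tt)
open import Data.Vec using ([]; _∷_; lookup)
open import Data.Vec.Properties using ([]=⇒lookup; lookup⇒[]=)
open import Function using (Equivalence; case_of_; id)
open import Level using (0ℓ)
open import Relation.Binary.Definitions using (tri<; tri≈; tri>)
open import Relation.Binary.PropositionalEquality
open import Relation.Binary.Structures using (IsStrictTotalOrder)
open import Relation.Nullary using (¬_; Dec; yes; no; does; proof)
open import Relation.Nullary.Decidable using (¬?; _×-dec_; _→-dec_; dec-true; dec-false)
open import Relation.Nullary.Reflects using (Reflects; ofʸ; ofⁿ; invert; det)

module Codewords where
  open import Data.Nat using (_+_; _∸_; _≤_; _<_)

  ≡ᵇ-refl : ∀ m → (m ≡ᵇ m) ≡ true
  ≡ᵇ-refl zero    = refl
  ≡ᵇ-refl (suc m) = ≡ᵇ-refl m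

  ≡ᵇ⇒≡ : ∀ {m n} → (m ≡ᵇ n) ≡ true → m ≡ n
  ≡ᵇ⇒≡ {m} {n} e = ℕₚ.≡ᵇ⇒≡ m n (Equivalence.from T-≡ e)

  contradictionᵇ : ∀ {b} {A : Set} → b ≡ true → b ≡ false → A
  contradictionᵇ refl ()

  ≡⇒≡ᵇ≡true : ∀ {m n} → m ≡ n → (m ≡ᵇ n) ≡ true
  ≡⇒≡ᵇ≡true {m} refl = ≡ᵇ-refl m

  ≢⇒≡ᵇ≡false : ∀ {m n} → m ≢ n → (m ≡ᵇ n) ≡ false
  ≢⇒≡ᵇ≡false {m} {n} m≢n with m ≡ᵇ n in eq
  ... | true  = ⊥-elim (m≢n (≡ᵇ⇒≡ eq))
  ... | false = refl

  <⇒≡ᵇ≡false : ∀ {m n} → m < n → (m ≡ᵇ n) ≡ false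
  <⇒≡ᵇ≡false m<n = ≢⇒≡ᵇ≡false (ℕₚ.<⇒≢ m<n)

  >⇒≡ᵇ≡false : ∀ {m n} → n < m → (m ≡ᵇ n) ≡ false
  >⇒≡ᵇ≡false n<m = ≢⇒≡ᵇ≡false (ℕₚ.>⇒≢ n<m)

  +-≡ᵇ : ∀ k m n → (k + m ≡ᵇ k + n) ≡ (m ≡ᵇ n)
  +-≡ᵇ zero    m n = refl
  +-≡ᵇ (suc k) m n = +-≡ᵇ k m n

  ≤⇒≤ᵇ≡true : ∀ {m n} → m ≤ n → (m ≤ᵇ n) ≡ true
  ≤⇒≤ᵇ≡true m≤n = Equivalence.to T-≡ (ℕₚ.≤⇒≤ᵇ m≤n)

  >⇒≤ᵇ≡false : ∀ {m n} → n < m → (m ≤ᵇ n) ≡ false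
  >⇒≤ᵇ≡false {m} {n} n<m with m ≤ᵇ n in eq
  ... | true  = ⊥-elim (ℕₚ.<⇒≱ n<m (ℕₚ.≤ᵇ⇒≤ m n (Equivalence.from T-≡ eq)))
  ... | false = refl

  >⇒inRange≡false : ∀ {m k} → m < k → inRange m k ≡ false
  >⇒inRange≡false {m} {k} m<k rewrite >⇒≤ᵇ≡false m<k = ∧-zeroʳ (1 ≤ᵇ k)

  ≤⇒inRange≡true : ∀ {m k} → 1 ≤ k → k ≤ m → inRange m k ≡ true
  ≤⇒inRange≡true {m} {k} 1≤k k≤m rewrite ≤⇒≤ᵇ≡true 1≤k | ≤⇒≤ᵇ≡true k≤m = refl

  inRange-label : ∀ {m} (k : Fin m) → inRange m (label k) ≡ true
  inRange-label k = ≤⇒≤ᵇ≡true (Finₚ.toℕ<n k)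

  label-≢ : ∀ {m} {k j : Fin m} → k ≢ j → label k ≢ label j
  label-≢ k≢j e = k≢j (Finₚ.toℕ-injective (ℕₚ.suc-injective e))

  inRange⇒label : ∀ {m j} → inRange m j ≡ true → Σ (Fin m) λ k → label k ≡ j
  inRange⇒label {m} {suc j} e = fromℕ< j<m , cong suc (Finₚ.toℕ-fromℕ< j<m)
    where
    j<m : j < m
    j<m = ℕₚ.≤ᵇ⇒≤ (suc j) m (Equivalence.from T-≡ e)

  ∈⇒true : ∀ {N} {σ : Subset N} {x l} f → σ ≐ f → label x ≡ l → x ∈ σ → f l ≡ true
  ∈⇒true f σ≐f refl x∈σ = trans (sym (σ≐f _)) ([]=⇒lookup x∈σ)

  true⇒∈ : ∀ {N} {σ : Subset N} {l} f x → σ ≐ f → label x ≡ l → f l ≡ true → x ∈ σ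
  true⇒∈ {σ = σ} f x σ≐f refl fₗ = lookup⇒[]= x σ (trans (σ≐f x) fₗ)

  -- Named copies of the indicators in the constructors of 𝒞 (definitionally equal to them).

  full : ℕ → ℕ → Bool
  full n k = inRange (suc n) k ∨ (k ≡ᵇ n + n + 2)

  miss : ℕ → ℕ → ℕ → Bool
  miss n i k = (inRange n k ∧ not (k ≡ᵇ i)) ∨ (k ≡ᵇ suc n) ∨ (k ≡ᵇ suc n + i)

  trunk : ℕ → (ℕ → Bool) → ℕ → Bool
  trunk n P k = (inRange n k ∧ P k) ∨ (k ≡ᵇ suc n)

  single : ℕ → ℕ → ℕ → Bool
  single n i k = k ≡ᵇ suc n + i

  top : ℕ → ℕ → Bool
  top n k = (suc (suc n) ≤ᵇ k) ∧ (k ≤ᵇ n + n + 2)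

  data LabelView (n : ℕ) : ℕ → Set where
    low  : (k : Fin n) → LabelView n (label k)
    mid  : LabelView n (suc n)
    high : (k : Fin n) → LabelView n (suc n + label k)
    last : LabelView n (n + n + 2)

  n+n+2≡[1+n]+[1+n] : ∀ n → n + n + 2 ≡ suc n + suc n
  n+n+2≡[1+n]+[1+n] n = trans (ℕₚ.+-comm (n + n) 2) (cong suc (sym (ℕₚ.+-suc n n)))

  labelView : ∀ {n} (x : Fin (n + n + 2)) → LabelView n (label x)
  labelView {n} x = view (toℕ x) (Finₚ.toℕ<n x)
    where
    above : ∀ r → r ≤ n → LabelView n (suc n + suc r)
    above r r≤n with ℕₚ.m≤n⇒m<n∨m≡n r≤n
    ... | inj₁ r<n = subst (λ t → LabelView n (suc n + suc t)) (Finₚ.toℕ-fromℕ< r<n) (high (fromℕ< r<n))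
    ... | inj₂ refl = subst (LabelView n) (n+n+2≡[1+n]+[1+n] n) last
    view : ∀ m → m < n + n + 2 → LabelView n (suc m)
    view m m<M with ℕₚ.<-cmp m n
    ... | tri< m<n _ _ = subst (LabelView n) (cong suc (Finₚ.toℕ-fromℕ< m<n)) (low (fromℕ< m<n))
    ... | tri≈ _ refl _ = mid
    ... | tri> _ _ n<m = subst (LabelView n) [1+n]+[1+r]≡1+m (above r r≤n)
      where
      r : ℕ
      r = m ∸ suc n
      [1+n]+r≡m : suc n + r ≡ m
      [1+n]+r≡m = ℕₚ.m+[n∸m]≡n n<m
      r≤n : r ≤ n
      r≤n = ℕₚ.≤-pred (ℕₚ.+-cancelˡ-< (suc n) r (suc n)
              (subst₂ _<_ (sym [1+n]+r≡m) (n+n+2≡[1+n]+[1+n] n) m<M))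
      [1+n]+[1+r]≡1+m : suc n + suc r ≡ suc m
      [1+n]+[1+r]≡1+m = trans (ℕₚ.+-suc (suc n) r) (cong suc [1+n]+r≡m)

  module LabelValues (n : ℕ) where

    private
      label≤n : (k : Fin n) → label k ≤ n
      label≤n = Finₚ.toℕ<n

      label<1+n+ : (k : Fin n) (j : ℕ) → label k < suc n + j
      label<1+n+ k j = s≤s (ℕₚ.≤-trans (label≤n k) (ℕₚ.m≤m+n n j))

      mid<high : (k : Fin n) → suc n < suc n + label k
      mid<high k = ℕₚ.m<m+n (suc n) (s≤s z≤n)

      high<last : (k : Fin n) → suc n + label k < n + n + 2
      high<last k = subst (suc n + label k <_) (sym (n+n+2≡[1+n]+[1+n] n))
                      (ℕₚ.+-monoʳ-< (suc n) (s≤s (label≤n k)))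

      mid<last : suc n < n + n + 2
      mid<last = subst (suc n <_) (sym (n+n+2≡[1+n]+[1+n] n)) (ℕₚ.m<m+n (suc n) (s≤s z≤n))

    full-low : (k : Fin n) → full n (label k) ≡ true
    full-low k rewrite ≤⇒≤ᵇ≡true (ℕₚ.m≤n⇒m≤1+n (label≤n k)) = refl

    full-mid : full n (suc n) ≡ true
    full-mid rewrite ≤⇒≤ᵇ≡true (ℕₚ.≤-refl {suc n}) = refl

    full-high : (k : Fin n) → full n (suc n + label k) ≡ false
    full-high k rewrite >⇒inRange≡false {suc n} (mid<high k) | <⇒≡ᵇ≡false (high<last k) = refl

    full-last : full n (n + n + 2) ≡ true
    full-last rewrite ≡ᵇ-refl (n + n + 2) = ∨-zeroʳ _

    miss-low : (k : Fin n) (j : ℕ) → miss n j (label k) ≡ not (label k ≡ᵇ j)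
    miss-low k j rewrite inRange-label k | <⇒≡ᵇ≡false (label≤n k)
                       | <⇒≡ᵇ≡false (ℕₚ.≤-trans (label≤n k) (ℕₚ.m≤m+n n j)) = ∨-identityʳ _

    miss-mid : (j : ℕ) → miss n j (suc n) ≡ true
    miss-mid j rewrite ≡ᵇ-refl n = ∨-zeroʳ _

    miss-above : ∀ {l} (j : ℕ) → suc n < l → miss n j l ≡ (l ≡ᵇ suc n + j)
    miss-above j n<l rewrite >⇒inRange≡false (ℕₚ.<-trans (ℕₚ.n<1+n n) n<l)
                           | >⇒≡ᵇ≡false n<l = refl

    miss-high : (k : Fin n) (j : ℕ) → miss n j (suc n + label k) ≡ (label k ≡ᵇ j)
    miss-high k j = trans (miss-above j (mid<high k)) (+-≡ᵇ (suc n) (label k) j)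

    miss-last : (j : ℕ) → miss n j (n + n + 2) ≡ (suc n ≡ᵇ j)
    miss-last j = begin
      miss n j (n + n + 2)           ≡⟨ miss-above j mid<last ⟩
      (n + n + 2 ≡ᵇ suc n + j)       ≡⟨ cong (_≡ᵇ suc n + j) (n+n+2≡[1+n]+[1+n] n) ⟩
      (suc n + suc n ≡ᵇ suc n + j)   ≡⟨ +-≡ᵇ (suc n) (suc n) j ⟩
      (suc n ≡ᵇ j)                   ∎
      where open ≡-Reasoning

    trunk-low : (k : Fin n) (P : ℕ → Bool) → trunk n P (label k) ≡ P (label k)
    trunk-low k P rewrite inRange-label k | <⇒≡ᵇ≡false (label≤n k) = ∨-identityʳ _

    trunk-mid : (P : ℕ → Bool) → trunk n P (suc n) ≡ true
    trunk-mid P rewrite ≡ᵇ-refl n = ∨-zeroʳ _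

    trunk-above : ∀ {l} (P : ℕ → Bool) → suc n < l → trunk n P l ≡ false
    trunk-above P n<l rewrite >⇒inRange≡false (ℕₚ.<-trans (ℕₚ.n<1+n n) n<l)
                            | >⇒≡ᵇ≡false n<l = refl

    trunk-high : (k : Fin n) (P : ℕ → Bool) → trunk n P (suc n + label k) ≡ false
    trunk-high k P = trunk-above P (mid<high k)

    trunk-last : (P : ℕ → Bool) → trunk n P (n + n + 2) ≡ false
    trunk-last P = trunk-above P mid<last

    single-low : (k : Fin n) (j : ℕ) → single n j (label k) ≡ false
    single-low k j = <⇒≡ᵇ≡false (label<1+n+ k j)

    single-mid : ∀ {j} → 1 ≤ j → single n j (suc n) ≡ false
    single-mid 1≤j = <⇒≡ᵇ≡false (ℕₚ.m<m+n (suc n) 1≤j)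

    single-high : (k : Fin n) (j : ℕ) → single n j (suc n + label k) ≡ (label k ≡ᵇ j)
    single-high k j = +-≡ᵇ (suc n) (label k) j

    single-last : (j : ℕ) → single n j (n + n + 2) ≡ (suc n ≡ᵇ j)
    single-last j = trans (cong (_≡ᵇ suc n + j) (n+n+2≡[1+n]+[1+n] n)) (+-≡ᵇ (suc n) (suc n) j)

    top-below : ∀ {l} → l ≤ suc n → top n l ≡ false
    top-below l≤n rewrite >⇒≤ᵇ≡false (s≤s l≤n) = refl

    top-high : (k : Fin n) → top n (suc n + label k) ≡ true
    top-high k rewrite ≤⇒≤ᵇ≡true (mid<high k) | ≤⇒≤ᵇ≡true (ℕₚ.<⇒≤ (high<last k)) = refl

    top-last : top n (n + n + 2) ≡ true
    top-last rewrite ≤⇒≤ᵇ≡true mid<last | ≤⇒≤ᵇ≡true (ℕₚ.≤-refl {n + n + 2}) = refl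

    midNeuron : Fin (n + n + 2)
    midNeuron = fromℕ< (ℕₚ.<-trans (ℕₚ.n<1+n n) mid<last)

    label-midNeuron : label midNeuron ≡ suc n
    label-midNeuron = cong suc (Finₚ.toℕ-fromℕ< _)

    indicator : ∀ {σ} → 𝒞 n σ → ℕ → Bool
    indicator (c-empty _)       = λ _ → false
    indicator (c-trunk P _ _ _) = trunk n P
    indicator (c-single j _ _)  = single n j
    indicator (c-miss j _ _)    = miss n j
    indicator (c-full _)        = full n
    indicator (c-top _)         = top n

    indicator-≐ : ∀ {σ} (c : 𝒞 n σ) → σ ≐ indicator c
    indicator-≐ (c-empty σ≐)       = σ≐
    indicator-≐ (c-trunk _ _ _ σ≐) = σ≐
    indicator-≐ (c-single _ _ σ≐)  = σ≐
    indicator-≐ (c-miss _ _ σ≐)    = σ≐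
    indicator-≐ (c-full σ≐)        = σ≐
    indicator-≐ (c-top σ≐)         = σ≐

    through-low⇒through-mid : ∀ {σ} (c : 𝒞 n σ) (k : Fin n) →
                              indicator c (label k) ≡ true → indicator c (suc n) ≡ true
    through-low⇒through-mid (c-empty _)       k ()
    through-low⇒through-mid (c-trunk P _ _ _) k _ = trunk-mid P
    through-low⇒through-mid (c-single j _ _)  k e = contradictionᵇ e (single-low k j)
    through-low⇒through-mid (c-miss j _ _)    k _ = miss-mid j
    through-low⇒through-mid (c-full _)        k _ = full-mid
    through-low⇒through-mid (c-top _)         k e = contradictionᵇ e (top-below (ℕₚ.m≤n⇒m≤1+n (label≤n k)))

    through-high : ∀ {σ} (c : 𝒞 n σ) (k : Fin n) → indicator c (suc n + label k) ≡ true →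
                   σ ≐ miss n (label k) ⊎ σ ≐ single n (label k) ⊎ σ ≐ top n
    through-high (c-empty _)       k ()
    through-high (c-trunk P _ _ _) k e = contradictionᵇ e (trunk-high k P)
    through-high {σ} (c-single j _ σ≐) k e =
      inj₂ (inj₁ (subst (λ j → σ ≐ single n j) (sym (≡ᵇ⇒≡ (trans (sym (single-high k j)) e))) σ≐))
    through-high {σ} (c-miss j _ σ≐) k e =
      inj₁ (subst (λ j → σ ≐ miss n j) (sym (≡ᵇ⇒≡ (trans (sym (miss-high k j)) e))) σ≐)
    through-high (c-full _)        k e = contradictionᵇ e (full-high k)
    through-high (c-top σ≐)        k _ = inj₂ (inj₂ σ≐)

    through-last : ∀ {σ} (c : 𝒞 n σ) → indicator c (n + n + 2) ≡ true →
                   σ ≐ full n ⊎ σ ≐ single n (suc n) ⊎ σ ≐ top n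
    through-last (c-empty _)       ()
    through-last (c-trunk P _ _ _) e = contradictionᵇ e (trunk-last P)
    through-last {σ} (c-single j _ σ≐) e =
      inj₂ (inj₁ (subst (λ j → σ ≐ single n j) (sym (≡ᵇ⇒≡ (trans (sym (single-last j)) e))) σ≐))
    through-last (c-miss j j∈[n] _) e =
      contradictionᵇ j∈[n]
        (>⇒inRange≡false {k = j} (subst (n <_) (≡ᵇ⇒≡ (trans (sym (miss-last j)) e)) (ℕₚ.n<1+n n)))
    through-last (c-full σ≐)       _ = inj₁ σ≐
    through-last (c-top σ≐)        _ = inj₂ (inj₂ σ≐)

    miss∩top : ∀ {l} (k : Fin n) → LabelView n l → miss n (label k) l ≡ true → top n l ≡ true →
               l ≡ suc n + label k
    miss∩top k (low k′)  _ t = contradictionᵇ t (top-below (ℕₚ.m≤n⇒m≤1+n (label≤n k′)))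
    miss∩top k mid       _ t = contradictionᵇ t (top-below ℕₚ.≤-refl)
    miss∩top k (high k′) m _ = cong (suc n +_) (≡ᵇ⇒≡ (trans (sym (miss-high k′ (label k))) m))
    miss∩top k last      m _ = contradictionᵇ m (trans (miss-last (label k)) (>⇒≡ᵇ≡false (s≤s (label≤n k))))

    full∩top : ∀ {l} → LabelView n l → full n l ≡ true → top n l ≡ true → l ≡ suc n + suc n
    full∩top (low k)  _ t = contradictionᵇ t (top-below (ℕₚ.m≤n⇒m≤1+n (label≤n k)))
    full∩top mid      _ t = contradictionᵇ t (top-below ℕₚ.≤-refl)
    full∩top (high k) f _ = contradictionᵇ f (full-high k)
    full∩top last     _ _ = n+n+2≡[1+n]+[1+n] n

open Codewords

module Heights where
  open import Data.Nat using (_+_; _≤_; _<_)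

  count : (ℕ → Bool) → ℕ → ℕ
  count P zero    = 0
  count P (suc t) = if P (suc t) then suc (count P t) else count P t

  count-ascent : ∀ P t → P (suc t) ≡ true → count P t < count P (suc t)
  count-ascent P t e rewrite e = ℕₚ.≤-refl

  count-flat : ∀ P t → P (suc t) ≡ false → count P (suc t) ≡ count P t
  count-flat P t e rewrite e = refl

  count-step : ∀ P t → count P t ≤ count P (suc t)
  count-step P t with P (suc t)
  ... | true  = ℕₚ.n≤1+n _
  ... | false = ℕₚ.≤-refl

  count-mono : ∀ P {t u} → t ≤ u → count P t ≤ count P u
  count-mono P {u = zero}  z≤n = ℕₚ.≤-refl
  count-mono P {u = suc u} t≤1+u with ℕₚ.m≤n⇒m<n∨m≡n t≤1+u
  ... | inj₁ t<1+u = ℕₚ.≤-trans (count-mono P (ℕₚ.≤-pred t<1+u)) (count-step P u)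
  ... | inj₂ refl  = ℕₚ.≤-refl

  -- Rises by 2 at every step except step j, where it falls by 1.
  dip : ℕ → ℕ → ℕ
  dip j t = if suc t ≤ᵇ j then 3 + (t + t) else t + t

  private
    double-< : ∀ t → t + t < suc t + suc t
    double-< t = ℕₚ.+-mono-< (ℕₚ.n<1+n t) (ℕₚ.n<1+n t)

  dip-ascent : ∀ j t → suc t ≢ j → dip j t < dip j (suc t)
  dip-ascent j t 1+t≢j with ℕₚ.<-cmp (suc t) j
  ... | tri< 1+t<j _ _ rewrite ≤⇒≤ᵇ≡true (ℕₚ.<⇒≤ 1+t<j) | ≤⇒≤ᵇ≡true 1+t<j =
    ℕₚ.+-monoʳ-< 3 (double-< t)
  ... | tri≈ _ 1+t≡j _ = ⊥-elim (1+t≢j 1+t≡j)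
  ... | tri> _ _ j<1+t rewrite >⇒≤ᵇ≡false j<1+t | >⇒≤ᵇ≡false (ℕₚ.m<n⇒m<1+n j<1+t) = double-< t

  dip-descent : ∀ t → dip (suc t) (suc t) < dip (suc t) t
  dip-descent t rewrite >⇒≤ᵇ≡false (ℕₚ.n<1+n (suc t)) | ≤⇒≤ᵇ≡true (ℕₚ.≤-refl {suc t})
    = s≤s (s≤s (ℕₚ.≤-reflexive (ℕₚ.+-suc t t)))

  dip-first<last : ∀ {j n} → 1 ≤ j → j ≤ n → 2 ≤ n → dip j 0 < dip j n
  dip-first<last {j} {n} 1≤j j≤n 2≤n rewrite ≤⇒≤ᵇ≡true 1≤j | >⇒≤ᵇ≡false (s≤s j≤n) =
    ℕₚ.+-mono-≤ 2≤n 2≤n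

open Heights

module _ (R : RealField) where
  open RealField R
  open IsStrictTotalOrder isStrictTotalOrder
    using (compare; _<?_) renaming (trans to <-trans; irrefl to <-irrefl; asym to <-asym)
  open Geometry R

  private
    commutativeRing : CommutativeRing 0ℓ 0ℓ
    commutativeRing = record { isCommutativeRing = isCommutativeRing }

  open CommutativeRing commutativeRing
    using (+-assoc; +-comm; +-identityˡ; +-identityʳ; *-identityˡ; *-identityʳ;
           distribˡ; distribʳ; zeroˡ; zeroʳ; -‿inverseˡ; -‿inverseʳ; +-commutativeSemigroup)
  open RingProperties (CommutativeRing.ring commutativeRing)
    using (-0#≈0#; -‿+-comm; -‿distribʳ-*; -‿involutive)
  open CommutativeSemigroupProperties +-commutativeSemigroup using (interchange)

  <-irrefl′ : ∀ {x} → ¬ (x < x)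
  <-irrefl′ = <-irrefl refl

  x-y+y≡x : ∀ x y → (x + - y) + y ≡ x
  x-y+y≡x x y = trans (+-assoc x (- y) y) (trans (cong (x +_) (-‿inverseˡ y)) (+-identityʳ x))

  x<y⇒0<y-x : ∀ {x y} → x < y → 0# < y + - x
  x<y⇒0<y-x {x} {y} x<y = subst (_< y + - x) (-‿inverseʳ x) (+-mono-< x y (- x) x<y)

  0<y-x⇒x<y : ∀ {x y} → 0# < y + - x → x < y
  0<y-x⇒x<y {x} {y} 0<y-x = subst₂ _<_ (+-identityˡ x) (x-y+y≡x y x) (+-mono-< 0# (y + - x) x 0<y-x)

  +-pos : ∀ {x y} → 0# < x → 0# < y → 0# < x + y
  +-pos {x} {y} 0<x 0<y = <-trans 0<y (subst (_< x + y) (+-identityˡ y) (+-mono-< 0# x y 0<x))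

  -‿anti-< : ∀ {x y} → x < y → - y < - x
  -‿anti-< {x} {y} x<y = subst₂ _<_ lhs rhs (+-mono-< x y (- x + - y) x<y)
    where
    open ≡-Reasoning
    lhs : x + (- x + - y) ≡ - y
    lhs = begin
      x + (- x + - y)  ≡⟨ +-assoc x (- x) (- y) ⟨
      (x + - x) + - y  ≡⟨ cong (_+ - y) (-‿inverseʳ x) ⟩
      0# + - y         ≡⟨ +-identityˡ (- y) ⟩
      - y              ∎
    rhs : y + (- x + - y) ≡ - x
    rhs = begin
      y + (- x + - y)  ≡⟨ cong (y +_) (+-comm (- x) (- y)) ⟩
      y + (- y + - x)  ≡⟨ +-assoc y (- y) (- x) ⟨
      (y + - y) + - x  ≡⟨ cong (_+ - x) (-‿inverseʳ y) ⟩
      0# + - x         ≡⟨ +-identityˡ (- x) ⟩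
      - x              ∎

  -- 1 < 0 would make -1 positive, and then 1 = (-1)(-1) positive as well.
  0<1 : 0# < 1#
  0<1 with compare 0# 1#
  ... | tri< 0<1 _ _ = 0<1
  ... | tri≈ _ 0≡1 _ = ⊥-elim (0≢1 0≡1)
  ... | tri> _ _ 1<0 = ⊥-elim (<-asym 1<0 (subst (0# <_) [-1][-1]≡1 (*-pos (- 1#) (- 1#) 0<-1 0<-1)))
    where
    0<-1 : 0# < - 1#
    0<-1 = subst₂ _<_ (-‿inverseʳ 1#) (+-identityˡ (- 1#)) (+-mono-< 1# 0# (- 1#) 1<0)
    [-1][-1]≡1 : - 1# * - 1# ≡ 1#
    [-1][-1]≡1 = trans (sym (-‿distribʳ-* (- 1#) 1#)) (trans (cong -_ (*-identityʳ (- 1#))) (-‿involutive 1#))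

  private
    halfInverse : Σ ℝ λ h → (1# + 1#) * h ≡ 1#
    halfInverse = inverse (1# + 1#) λ 1+1≡0 → <-irrefl′ (subst (0# <_) 1+1≡0 (+-pos 0<1 0<1))

  half : ℝ
  half = proj₁ halfInverse

  half+half≡1 : half + half ≡ 1#
  half+half≡1 = trans (sym (cong₂ _+_ (*-identityˡ half) (*-identityˡ half)))
                      (trans (sym (distribʳ half 1# 1#)) (proj₂ halfInverse))

  x*half+x*half≡x : ∀ x → x * half + x * half ≡ x
  x*half+x*half≡x x = begin
    x * half + x * half      ≡⟨ distribˡ x half half ⟨
    x * (half + half)        ≡⟨ cong (x *_) half+half≡1 ⟩
    x * 1#                   ≡⟨ *-identityʳ x ⟩
    x                        ∎
    where open ≡-Reasoning

  0<half : 0# < half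
  0<half with compare 0# half
  ... | tri< 0<h _ _ = 0<h
  ... | tri≈ _ 0≡h _ = ⊥-elim (0≢1 (trans (sym (+-identityˡ 0#)) (trans (cong₂ _+_ 0≡h 0≡h) half+half≡1)))
  ... | tri> _ _ h<0 = ⊥-elim (<-irrefl′ (subst (0# <_) (-‿inverseʳ 1#) (+-pos 0<1 0<-1)))
    where
    0<-h : 0# < - half
    0<-h = subst (0# <_) (+-identityˡ (- half)) (x<y⇒0<y-x h<0)
    0<-1 : 0# < - 1#
    0<-1 = subst (0# <_) (trans (-‿+-comm half half) (cong -_ half+half≡1)) (+-pos 0<-h 0<-h)

  fromℕ : ℕ → ℝ
  fromℕ zero    = 0#
  fromℕ (suc k) = fromℕ k + 1#

  fromℕ-<-suc : ∀ k → fromℕ k < fromℕ (suc k)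
  fromℕ-<-suc k = subst₂ _<_ (+-identityˡ (fromℕ k)) (+-comm 1# (fromℕ k)) (+-mono-< 0# 1# (fromℕ k) 0<1)

  fromℕ-mono-< : ∀ {k l} → k ℕ.< l → fromℕ k < fromℕ l
  fromℕ-mono-< {k} {suc l} k<1+l with ℕₚ.m<1+n⇒m<n∨m≡n k<1+l
  ... | inj₁ k<l  = <-trans (fromℕ-mono-< k<l) (fromℕ-<-suc l)
  ... | inj₂ refl = fromℕ-<-suc l

  fromℕ-≤⇒≮ : ∀ {k l} → l ℕ.≤ k → ¬ (fromℕ k < fromℕ l)
  fromℕ-≤⇒≮ l≤k k<l with ℕₚ.m≤n⇒m<n∨m≡n l≤k
  ... | inj₁ l<k  = <-asym k<l (fromℕ-mono-< l<k)
  ... | inj₂ refl = <-irrefl′ k<l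

  -- Coordinates are indexed by ℕ; out-of-range coordinates read as 0#.
  at : ∀ {d} → Point d → ℕ → ℝ
  at []       _       = 0#
  at (x ∷ xs) zero    = x
  at (x ∷ xs) (suc u) = at xs u

  at-segment : ∀ {d} t (p q : Point d) u → at (segment t p q) u ≡ t * at p u + (1# + - t) * at q u
  at-segment t []      []      u       = sym (trans (cong₂ _+_ (zeroʳ t) (zeroʳ (1# + - t))) (+-identityʳ 0#))
  at-segment t (x ∷ p) (y ∷ q) zero    = refl
  at-segment t (x ∷ p) (y ∷ q) (suc u) = at-segment t p q u

  tabulateℕ : (d : ℕ) → (ℕ → ℝ) → Point d
  tabulateℕ zero    f = []
  tabulateℕ (suc d) f = f 0 ∷ tabulateℕ d (λ u → f (suc u))

  at-tabulateℕ : ∀ d f {u} → u ℕ.< d → at (tabulateℕ d f) u ≡ f u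
  at-tabulateℕ (suc d) f {zero}  _         = refl
  at-tabulateℕ (suc d) f {suc u} (s≤s u<d) = at-tabulateℕ d (λ v → f (suc v)) u<d

  CoordLt : ∀ {d} → ℕ → ℕ → Point d → Set
  CoordLt u v p = at p u < at p v

  0<convexCombination : ∀ {x y t} → 0# < x → 0# < y → 0# ≤ t → t ≤ 1# →
                        0# < t * x + (1# + - t) * y
  0<convexCombination {x} {y} 0<x 0<y (inj₂ refl) _ = subst (0# <_) (sym t≡0) 0<y
    where
    t≡0 : 0# * x + (1# + - 0#) * y ≡ y
    t≡0 = trans (cong₂ _+_ (zeroˡ x) (cong (_* y) (trans (cong (1# +_) -0#≈0#) (+-identityʳ 1#))))
                (trans (+-identityˡ _) (*-identityˡ y))
  0<convexCombination {x} {y} 0<x 0<y (inj₁ _) (inj₂ refl) = subst (0# <_) (sym t≡1) 0<x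
    where
    t≡1 : 1# * x + (1# + - 1#) * y ≡ x
    t≡1 = trans (cong₂ _+_ (*-identityˡ x) (trans (cong (_* y) (-‿inverseʳ 1#)) (zeroˡ y))) (+-identityʳ x)
  0<convexCombination {x} {y} {t} 0<x 0<y (inj₁ 0<t) (inj₁ t<1) =
    +-pos (*-pos t x 0<t 0<x) (*-pos (1# + - t) y (x<y⇒0<y-x t<1) 0<y)

  combination-difference : ∀ t s a b c d → (t * a + s * b) + - (t * c + s * d) ≡ t * (a + - c) + s * (b + - d)
  combination-difference t s a b c d = begin
    (t * a + s * b) + - (t * c + s * d)          ≡⟨ cong ((t * a + s * b) +_) (-‿+-comm (t * c) (s * d)) ⟨
    (t * a + s * b) + (- (t * c) + - (s * d))    ≡⟨ interchange (t * a) (s * b) (- (t * c)) (- (s * d)) ⟩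
    (t * a + - (t * c)) + (s * b + - (s * d))    ≡⟨ cong₂ _+_ (cong (t * a +_) (-‿distribʳ-* t c))
                                                               (cong (s * b +_) (-‿distribʳ-* s d)) ⟩
    (t * a + t * - c) + (s * b + s * - d)        ≡⟨ cong₂ _+_ (distribˡ t a (- c)) (distribˡ s b (- d)) ⟨
    t * (a + - c) + s * (b + - d)                ∎
    where open ≡-Reasoning

  CoordLt-convex : ∀ {d} u v → IsConvex {d} (CoordLt u v)
  CoordLt-convex u v p q t pᵤ<pᵥ qᵤ<qᵥ 0≤t t≤1 =
    0<y-x⇒x<y (subst (0# <_) (sym difference) (0<convexCombination (x<y⇒0<y-x pᵤ<pᵥ) (x<y⇒0<y-x qᵤ<qᵥ) 0≤t t≤1))
    where
    difference : at (segment t p q) v + - at (segment t p q) u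
               ≡ t * (at p v + - at p u) + (1# + - t) * (at q v + - at q u)
    difference = trans (cong₂ (λ a b → a + - b) (at-segment t p q v) (at-segment t p q u))
                       (combination-difference t (1# + - t) (at p v) (at q v) (at p u) (at q u))

  InBox : ∀ {d} → ℝ → Point d → Point d → Set
  InBox {d} ε p q = ∀ (k : Fin d) → (- ε < lookup q k + - lookup p k) × (lookup q k + - lookup p k < ε)

  InBox-at : ∀ {d ε} (p q : Point d) → 0# < ε → InBox ε p q → ∀ u →
             (- ε < at q u + - at p u) × (at q u + - at p u < ε)
  InBox-at {ε = ε} []      []      0<ε _     u = subst (- ε <_) (sym 0-0≡0) (subst (- ε <_) -0#≈0# (-‿anti-< 0<ε))
                                       , subst (_< ε) (sym 0-0≡0) 0<ε
    where
    0-0≡0 : 0# + - 0# ≡ 0#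
    0-0≡0 = -‿inverseʳ 0#
  InBox-at (x ∷ p) (y ∷ q) 0<ε inBox zero    = inBox Fin.zero
  InBox-at (x ∷ p) (y ∷ q) 0<ε inBox (suc u) = InBox-at p q 0<ε (λ k → inBox (Fin.suc k)) u

  InBox-mono : ∀ {d δ ε} {p q : Point d} → δ < ε → InBox δ p q → InBox ε p q
  InBox-mono δ<ε inBox k = <-trans (-‿anti-< δ<ε) (proj₁ (inBox k)) , <-trans (proj₂ (inBox k)) δ<ε

  -- The box of radius (pᵥ - pᵤ)/2 around p lies in {q | qᵤ < qᵥ}, since pᵤ + ε = pᵥ - ε.
  CoordLt-open : ∀ {d} u v → IsOpen {d} (CoordLt u v)
  CoordLt-open u v p pᵤ<pᵥ = ε , 0<ε , λ q inBox → <-trans (qᵤ<pᵤ+ε q inBox) (pᵤ+ε<qᵥ q inBox)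
    where
    ε : ℝ
    ε = (at p v + - at p u) * half
    0<ε : 0# < ε
    0<ε = *-pos _ half (x<y⇒0<y-x pᵤ<pᵥ) 0<half
    pᵤ+ε≡pᵥ-ε : at p u + ε ≡ at p v + - ε
    pᵤ+ε≡pᵥ-ε = begin
      at p u + ε                    ≡⟨ +-identityʳ _ ⟨
      (at p u + ε) + 0#             ≡⟨ cong ((at p u + ε) +_) (-‿inverseʳ ε) ⟨
      (at p u + ε) + (ε + - ε)      ≡⟨ +-assoc (at p u) ε (ε + - ε) ⟩
      at p u + (ε + (ε + - ε))      ≡⟨ cong (at p u +_) (+-assoc ε ε (- ε)) ⟨
      at p u + ((ε + ε) + - ε)      ≡⟨ cong (λ z → at p u + (z + - ε)) (x*half+x*half≡x _) ⟩
      at p u + ((at p v + - at p u) + - ε) ≡⟨ +-assoc (at p u) (at p v + - at p u) (- ε) ⟨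
      (at p u + (at p v + - at p u)) + - ε ≡⟨ cong (_+ - ε) (trans (+-comm (at p u) _) (x-y+y≡x (at p v) (at p u))) ⟩
      at p v + - ε                  ∎
      where open ≡-Reasoning
    qᵤ<pᵤ+ε : ∀ q → InBox ε p q → at q u < at p u + ε
    qᵤ<pᵤ+ε q inBox = subst₂ _<_ (x-y+y≡x (at q u) (at p u)) (+-comm ε (at p u))
                        (+-mono-< _ _ (at p u) (proj₂ (InBox-at p q 0<ε inBox u)))
    pᵤ+ε<qᵥ : ∀ q → InBox ε p q → at p u + ε < at q v
    pᵤ+ε<qᵥ q inBox = subst₂ _<_ (trans (+-comm (- ε) (at p v)) (sym pᵤ+ε≡pᵥ-ε)) (x-y+y≡x (at q v) (at p v))
                        (+-mono-< _ _ (at p v) (proj₁ (InBox-at p q 0<ε inBox v)))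

  ⊤-convex : ∀ {d} → IsConvex {d} (λ _ → ⊤)
  ⊤-convex _ _ _ _ _ _ _ = tt

  ⊤-open : ∀ {d} → IsOpen {d} (λ _ → ⊤)
  ⊤-open _ _ = 1# , 0<1 , λ _ _ → tt

  ⊥-convex : ∀ {d} → IsConvex {d} (λ _ → ⊥)
  ⊥-convex _ _ _ ()

  ⊥-open : ∀ {d} → IsOpen {d} (λ _ → ⊥)
  ⊥-open _ ()

  ∩-convex : ∀ {d} {S T : Point d → Set} → IsConvex S → IsConvex T → IsConvex (λ p → S p × T p)
  ∩-convex S-convex T-convex p q t (sₚ , tₚ) (s′ , t′) 0≤t t≤1 =
    S-convex p q t sₚ s′ 0≤t t≤1 , T-convex p q t tₚ t′ 0≤t t≤1

  ∩-open : ∀ {d} {S T : Point d → Set} → IsOpen S → IsOpen T → IsOpen (λ p → S p × T p)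
  ∩-open S-open T-open p (s , t) with S-open p s | T-open p t
  ... | δ , 0<δ , ballS | ε , 0<ε , ballT with compare δ ε
  ... | tri< δ<ε _ _ = δ , 0<δ , λ q inBox → ballS q inBox , ballT q (InBox-mono {p = p} {q = q} δ<ε inBox)
  ... | tri≈ _ refl _ = δ , 0<δ , λ q inBox → ballS q inBox , ballT q inBox
  ... | tri> _ _ ε<δ = ε , 0<ε , λ q inBox → ballS q (InBox-mono {p = p} {q = q} ε<δ inBox) , ballT q inBox

  Π-convex : ∀ {d} {A : Set} {S : A → Point d → Set} → (∀ a → IsConvex (S a)) → IsConvex (λ p → ∀ a → S a p)
  Π-convex S-convex p q t sₚ s′ 0≤t t≤1 a = S-convex a p q t (sₚ a) (s′ a) 0≤t t≤1

  open-resp : ∀ {d} {S T : Point d → Set} → (∀ {p} → S p → T p) → (∀ {p} → T p → S p) → IsOpen S → IsOpen T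
  open-resp S⊆T T⊆S S-open p t with S-open p (T⊆S t)
  ... | ε , 0<ε , ball = ε , 0<ε , λ q inBox → S⊆T (ball q inBox)

  -- A premise not depending on the point is either true (giving S) or false (giving everything).
  ⇒-open : ∀ {d} {A : Set} {S : Point d → Set} → Dec A → IsOpen S → IsOpen (λ p → A → S p)
  ⇒-open (yes a) S-open = open-resp (λ s _ → s) (λ s → s a) S-open
  ⇒-open (no ¬a) S-open = open-resp (λ _ a → ⊥-elim (¬a a)) (λ _ → tt) ⊤-open

  ⋂-open : ∀ {d} m {S : Fin m → Point d → Set} → (∀ k → IsOpen (S k)) → IsOpen (λ p → ∀ k → S k p)
  ⋂-open zero    S-open = open-resp (λ _ ()) (λ _ → tt) ⊤-open
  ⋂-open (suc m) S-open = open-resp (λ { (s₀ , s) Fin.zero → s₀ ; (s₀ , s) (Fin.suc k) → s k })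
                                    (λ s → s Fin.zero , λ k → s (Fin.suc k))
                                    (∩-open (S-open Fin.zero) (⋂-open m (λ k → S-open (Fin.suc k))))

  Exhibits : ∀ {M d} → (Fin M → Point d → Set) → Point d → Subset M → Set
  Exhibits W p σ = ∀ x → Reflects (W x p) (lookup σ x)

  module _ {M d} (X : Point d → Set) (W : Fin M → Point d → Set) where

    private
      U : Fin M → Point d → Set
      U x p = X p × W x p

    exhibits⇒realised : ∀ {σ p} → X p → Exhibits W p σ → Realised X U σ
    exhibits⇒realised {σ} {p} Xp exhibits = p , Xp , inside , outside
      where
      inside : ∀ x → x ∈ σ → U x p
      inside x x∈σ = Xp , invert (subst (Reflects _) ([]=⇒lookup x∈σ) (exhibits x))
      outside : ∀ x → x ∉ σ → ¬ U x p
      outside x x∉σ (_ , w) = x∉σ (lookup⇒[]= x σ (det (exhibits x) (ofʸ w)))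

    realised⇒exhibits : ∀ {σ} → ((p , _ , _ , _) : Realised X U σ) → Exhibits W p σ
    realised⇒exhibits {σ} (p , Xp , inside , outside) x with lookup σ x in eq
    ... | true  = ofʸ (proj₂ (inside x (lookup⇒[]= x σ eq)))
    ... | false = ofⁿ λ w → outside x (λ x∈σ → true≢false (trans (sym ([]=⇒lookup x∈σ)) eq)) (Xp , w)
      where
      true≢false : true ≢ false
      true≢false ()

    convexCode-intro : {C : Code M} → IsConvex X → IsOpen X → (∀ x → IsConvex (W x)) → (∀ x → IsOpen (W x)) →
                       (∀ {σ} → C σ → Σ (Point d) λ p → X p × Exhibits W p σ) →
                       (∀ {σ p} → X p → Exhibits W p σ → C σ) →
                       IsConvexCode R C
    convexCode-intro X-convex X-open W-convex W-open realise classify =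
      d , X , U , X-convex , X-open ,
      (λ x → ∩-convex X-convex (W-convex x) , ∩-open X-open (W-open x) , λ _ → proj₁) ,
      λ σ → (λ σ∈C → let (p , Xp , exhibits) = realise σ∈C in exhibits⇒realised Xp exhibits)
          , (λ realised → classify (proj₁ (proj₂ realised)) (realised⇒exhibits realised))

  convexCode-resp : ∀ {M} {C D : Code M} → (∀ {σ} → C σ → D σ) → (∀ {σ} → D σ → C σ) →
                    IsConvexCode R C → IsConvexCode R D
  convexCode-resp C⊆D D⊆C (d , X , U , X-convex , X-open , U-props , realises) =
    d , X , U , X-convex , X-open , U-props ,
    λ σ → (λ σ∈D → proj₁ (realises σ) (D⊆C σ∈D)) , (λ realised → C⊆D (proj₂ (realises σ) realised))

  convexCode-trunk : ∀ {M} {C : Code M} (i : Fin M) → IsConvexCode R C → IsConvexCode R (λ σ → C σ × i ∈ σ)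
  convexCode-trunk {M} {C} i (d , X , U , _ , _ , U-props , realises) =
    d , U i , U′ , U-convex i , U-open i ,
    (λ j → ∩-convex (U-convex j) (U-convex i) , ∩-open (U-open j) (U-open i) , λ _ → proj₂) ,
    λ σ → restrict , extend
    where
    U-convex : ∀ j → IsConvex (U j)
    U-convex j = proj₁ (U-props j)
    U-open : ∀ j → IsOpen (U j)
    U-open j = proj₁ (proj₂ (U-props j))
    U′ : Fin M → Point d → Set
    U′ j p = U j p × U i p
    restrict : ∀ {σ} → C σ × i ∈ σ → Realised (U i) U′ σ
    restrict {σ} (σ∈C , i∈σ) with proj₁ (realises σ) σ∈C
    ... | p , _ , inside , outside =
      p , inside i i∈σ , (λ j j∈σ → inside j j∈σ , inside i i∈σ) , (λ j j∉σ (u , _) → outside j j∉σ u)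
    extend : ∀ {σ} → Realised (U i) U′ σ → C σ × i ∈ σ
    extend {σ} (p , Uᵢp , inside , outside) =
      proj₂ (realises σ) (p , proj₂ (proj₂ (U-props i)) p Uᵢp , (λ j j∈σ → proj₁ (inside j j∈σ)) ,
                          (λ j j∉σ u → outside j j∉σ (u , Uᵢp))) ,
      i∈σ
      where
      i∈σ : i ∈ σ
      i∈σ with i ∈? σ
      ... | yes i∈σ = i∈σ
      ... | no  i∉σ = ⊥-elim (outside i i∉σ (Uᵢp , Uᵢp))

  reflects-true : ∀ {A : Set} {b} → b ≡ true → A → Reflects A b
  reflects-true refl a = ofʸ a

  reflects-false : ∀ {A : Set} {b} → b ≡ false → ¬ A → Reflects A b
  reflects-false refl ¬a = ofⁿ ¬a

  HasPattern : ∀ {M d} → (Fin M → Point d → Set) → Point d → (ℕ → Bool) → Set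
  HasPattern W p f = ∀ x → Reflects (W x p) (f (label x))

  pattern⇒exhibits : ∀ {M d} {W : Fin M → Point d → Set} {p σ f} → σ ≐ f → HasPattern W p f → Exhibits W p σ
  pattern⇒exhibits σ≐f hasPattern x = subst (Reflects _) (sym (σ≐f x)) (hasPattern x)

  exhibits⇒≐ : ∀ {M d} {W : Fin M → Point d → Set} {p σ f} → Exhibits W p σ → HasPattern W p f → σ ≐ f
  exhibits⇒≐ exhibits hasPattern x = det (exhibits x) (hasPattern x)

  module _ {M : ℕ} (A B : ℕ → Bool) (c : ℕ) where

    -- The plane is split by the diagonal: A is shown above it, B below it, {c} on it.
    crossRegion : Bool → Bool → Bool → Point 2 → Set
    crossRegion true  _     _     = λ _ → ⊤
    crossRegion false true  _     = CoordLt 1 0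
    crossRegion false false true  = CoordLt 0 1
    crossRegion false false false = λ _ → ⊥

    crossRegion-above : ∀ {p} a b m → CoordLt 0 1 p →
                        (a ≡ true → m ≡ true) → (b ≡ true → m ≡ true → a ≡ true) →
                        Reflects (crossRegion a b m p) m
    crossRegion-above true  _     true  _     _   _   = ofʸ tt
    crossRegion-above true  _     false _     a⇒m _   = case a⇒m refl of λ ()
    crossRegion-above false true  true  _     _   b∧m = case b∧m refl refl of λ ()
    crossRegion-above false true  false p₀<p₁ _   _   = ofⁿ λ p₁<p₀ → <-asym p₁<p₀ p₀<p₁
    crossRegion-above false false true  p₀<p₁ _   _   = ofʸ p₀<p₁
    crossRegion-above false false false _     _   _   = ofⁿ λ ()

    crossRegion-diagonal : ∀ {p} a b m → at p 0 ≡ at p 1 → Reflects (crossRegion a b m p) a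
    crossRegion-diagonal true  _     _     _     = ofʸ tt
    crossRegion-diagonal {p} false true  _    p₀≡p₁ =
      ofⁿ λ p₁<p₀ → <-irrefl′ (subst (_< at p 0) (sym p₀≡p₁) p₁<p₀)
    crossRegion-diagonal {p} false false true p₀≡p₁ =
      ofⁿ λ p₀<p₁ → <-irrefl′ (subst (at p 0 <_) (sym p₀≡p₁) p₀<p₁)
    crossRegion-diagonal false false false _     = ofⁿ λ ()

    crossRegion-below : ∀ {p} a b m → CoordLt 1 0 p → (a ≡ true → b ≡ true) → Reflects (crossRegion a b m p) b
    crossRegion-below true  true  _     _     _   = ofʸ tt
    crossRegion-below true  false _     _     a⇒b = case a⇒b refl of λ ()
    crossRegion-below false true  _     p₁<p₀ _   = ofʸ p₁<p₀
    crossRegion-below false false true  p₁<p₀ _   = ofⁿ λ p₀<p₁ → <-asym p₀<p₁ p₁<p₀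
    crossRegion-below false false false _     _   = ofⁿ λ ()

    private
      W : Fin M → Point 2 → Set
      W x = crossRegion (label x ≡ᵇ c) (B (label x)) (A (label x))

      W-convex : ∀ x → IsConvex (W x)
      W-convex x = convex (label x ≡ᵇ c) (B (label x)) (A (label x))
        where
        convex : ∀ a b m → IsConvex (crossRegion a b m)
        convex true  _     _     = ⊤-convex
        convex false true  _     = CoordLt-convex 1 0
        convex false false true  = CoordLt-convex 0 1
        convex false false false = ⊥-convex

      W-open : ∀ x → IsOpen (W x)
      W-open x = open′ (label x ≡ᵇ c) (B (label x)) (A (label x))
        where
        open′ : ∀ a b m → IsOpen (crossRegion a b m)
        open′ true  _     _     = ⊤-open
        open′ false true  _     = CoordLt-open 1 0
        open′ false false true  = CoordLt-open 0 1
        open′ false false false = ⊥-open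

    crossCode-convex : {C : Code M} → A c ≡ true → B c ≡ true →
                       (∀ x → A (label x) ≡ true → B (label x) ≡ true → label x ≡ c) →
                       (∀ {σ} → C σ → σ ≐ A ⊎ σ ≐ (_≡ᵇ c) ⊎ σ ≐ B) →
                       (∀ {σ} → σ ≐ A → C σ) → (∀ {σ} → σ ≐ (_≡ᵇ c) → C σ) →
                       (∀ {σ} → σ ≐ B → C σ) →
                       IsConvexCode R C
    crossCode-convex {C} c∈A c∈B A∩B⊆c codewords A∈C c∈C B∈C =
      convexCode-intro (λ _ → ⊤) W ⊤-convex ⊤-open W-convex W-open realise classify
      where
      above : ∀ {p} → CoordLt 0 1 p → HasPattern W p A
      above p₀<p₁ x = crossRegion-above (label x ≡ᵇ c) (B (label x)) (A (label x)) p₀<p₁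
                        (λ x≡c → subst (λ l → A l ≡ true) (sym (≡ᵇ⇒≡ x≡c)) c∈A)
                        (λ x∈B x∈A → ≡⇒≡ᵇ≡true (A∩B⊆c x x∈A x∈B))
      onDiagonal : ∀ {p} → at p 0 ≡ at p 1 → HasPattern W p (_≡ᵇ c)
      onDiagonal p₀≡p₁ x = crossRegion-diagonal (label x ≡ᵇ c) (B (label x)) (A (label x)) p₀≡p₁
      below : ∀ {p} → CoordLt 1 0 p → HasPattern W p B
      below p₁<p₀ x = crossRegion-below (label x ≡ᵇ c) (B (label x)) (A (label x)) p₁<p₀
                        (λ x≡c → subst (λ l → B l ≡ true) (sym (≡ᵇ⇒≡ x≡c)) c∈B)
      realise : ∀ {σ} → C σ → Σ (Point 2) λ p → ⊤ × Exhibits W p σ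
      realise {σ} σ∈C with codewords σ∈C
      ... | inj₁ σ≐A        = (0# ∷ 1# ∷ []) , tt , pattern⇒exhibits {W = W} {σ = σ} {f = A} σ≐A (above 0<1)
      ... | inj₂ (inj₁ σ≐c) = (0# ∷ 0# ∷ []) , tt , pattern⇒exhibits {W = W} {σ = σ} {f = (_≡ᵇ c)} σ≐c (onDiagonal refl)
      ... | inj₂ (inj₂ σ≐B) = (1# ∷ 0# ∷ []) , tt , pattern⇒exhibits {W = W} {σ = σ} {f = B} σ≐B (below 0<1)
      classify : ∀ {σ p} → ⊤ → Exhibits W p σ → C σ
      classify {σ} {p} _ exhibits with compare (at p 0) (at p 1)
      ... | tri< p₀<p₁ _ _ = A∈C (exhibits⇒≐ {W = W} {σ = σ} {f = A} exhibits (above p₀<p₁))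
      ... | tri≈ _ p₀≡p₁ _ = c∈C (exhibits⇒≐ {W = W} {σ = σ} {f = (_≡ᵇ c)} exhibits (onDiagonal p₀≡p₁))
      ... | tri> _ _ p₁<p₀ = B∈C (exhibits⇒≐ {W = W} {σ = σ} {f = B} exhibits (below p₁<p₀))

  Ascent : ∀ {m d} → Fin m → Point d → Set
  Ascent k = CoordLt (toℕ k) (label k)

  ascent? : ∀ {m d} (k : Fin m) (p : Point d) → Dec (Ascent k p)
  ascent? k p = at p (toℕ k) <? at p (label k)

  ascent-inject₁ : ∀ {m d} {p : Point d} (k : Fin m) → Ascent k p → Ascent (Fin.inject₁ k) p
  ascent-inject₁ {p = p} k = subst (λ t → CoordLt t (suc t) p) (sym (Finₚ.toℕ-inject₁ k))

  ascent-exists : ∀ {d} m (p : Point d) → at p 0 < at p m → Σ (Fin m) λ k → Ascent k p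
  ascent-exists zero    p p₀<p₀ = ⊥-elim (<-irrefl′ p₀<p₀)
  ascent-exists (suc m) p p₀<pₘ₊₁ with compare (at p m) (at p (suc m))
  ... | tri< pₘ<pₘ₊₁ _ _ = Fin.fromℕ m , subst (λ t → CoordLt t (suc t) p) (sym (Finₚ.toℕ-fromℕ m)) pₘ<pₘ₊₁
  ... | tri≈ _ pₘ≡pₘ₊₁ _ = map Fin.inject₁ (λ {k} → ascent-inject₁ {p = p} k)
                             (ascent-exists m p (subst (at p 0 <_) (sym pₘ≡pₘ₊₁) p₀<pₘ₊₁))
  ... | tri> _ _ pₘ₊₁<pₘ = map Fin.inject₁ (λ {k} → ascent-inject₁ {p = p} k)
                             (ascent-exists m p (<-trans p₀<pₘ₊₁ pₘ₊₁<pₘ))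

  heights : (d : ℕ) → (ℕ → ℕ) → Point d
  heights d g = tabulateℕ d (λ u → fromℕ (g u))

  CoordLt-heights : ∀ {d} g {u v} → u ℕ.< d → v ℕ.< d → g u ℕ.< g v → CoordLt u v (heights d g)
  CoordLt-heights {d} g u<d v<d gᵤ<gᵥ =
    subst₂ _<_ (sym (at-tabulateℕ d _ u<d)) (sym (at-tabulateℕ d _ v<d)) (fromℕ-mono-< gᵤ<gᵥ)

  ¬CoordLt-heights : ∀ {d} g {u v} → u ℕ.< d → v ℕ.< d → g v ℕ.≤ g u → ¬ CoordLt u v (heights d g)
  ¬CoordLt-heights {d} g u<d v<d gᵥ≤gᵤ pᵤ<pᵥ =
    fromℕ-≤⇒≮ gᵥ≤gᵤ (subst₂ _<_ (at-tabulateℕ d _ u<d) (at-tabulateℕ d _ v<d) pᵤ<pᵥ)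

  module MiddleTrunk (n : ℕ) where
    open LabelValues n

    AllAscents : Point (suc n) → Set
    AllAscents p = ∀ k → Ascent {n} k p

    Dip : Fin n → Point (suc n) → Set
    Dip j p = (∀ k → k ≢ j → Ascent k p) × CoordLt (label j) (toℕ j) p

    dip? : ∀ j p → Dec (Dip j p)
    dip? j p = all? (λ k → ¬? (k Fin.≟ j) →-dec ascent? k p) ×-dec (at p (label j) <? at p (toℕ j))

    region : ∀ {l} → LabelView n l → Point (suc n) → Set
    region (low k)  = Ascent k
    region mid      = λ _ → ⊤
    region (high j) = Dip j
    region last     = AllAscents

    region-convex : ∀ {l} (v : LabelView n l) → IsConvex (region v)
    region-convex (low k)  = CoordLt-convex _ _
    region-convex mid      = ⊤-convex
    region-convex (high j) =
      ∩-convex (Π-convex λ (k : Fin n) → Π-convex λ _ → CoordLt-convex (toℕ k) (label k)) (CoordLt-convex _ _)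
    region-convex last     = Π-convex λ (k : Fin n) → CoordLt-convex (toℕ k) (label k)

    region-open : ∀ {l} (v : LabelView n l) → IsOpen (region v)
    region-open (low k)  = CoordLt-open _ _
    region-open mid      = ⊤-open
    region-open (high j) =
      ∩-open (⋂-open n λ k → ⇒-open (¬? (k Fin.≟ j)) (CoordLt-open (toℕ k) (label k))) (CoordLt-open _ _)
    region-open last     = ⋂-open n λ k → CoordLt-open (toℕ k) (label k)

    ViewPattern : Point (suc n) → (ℕ → Bool) → Set
    ViewPattern p f = ∀ {l} (v : LabelView n l) → Reflects (region v p) (f l)

    full-pattern : ∀ {p} → AllAscents p → ViewPattern p (full n)
    full-pattern ascents (low k)  = reflects-true (full-low k) (ascents k)
    full-pattern ascents mid      = reflects-true full-mid tt
    full-pattern ascents (high k) = reflects-false (full-high k) λ (_ , descent) → <-asym descent (ascents k)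
    full-pattern ascents last     = reflects-true full-last ascents

    miss-pattern : ∀ {p j} → Dip j p → ViewPattern p (miss n (label j))
    miss-pattern {j = j} (ascents , descent) (low k) with k Fin.≟ j
    ... | yes refl = reflects-false (trans (miss-low k (label k)) (cong not (≡ᵇ-refl (label k))))
                                    λ ascent → <-asym ascent descent
    ... | no  k≢j  = reflects-true (trans (miss-low k (label j)) (cong not (≢⇒≡ᵇ≡false (label-≢ k≢j))))
                                   (ascents k k≢j)
    miss-pattern {j = j} _ mid = reflects-true (miss-mid (label j)) tt
    miss-pattern {j = j} (ascents , descent) (high k) with k Fin.≟ j
    ... | yes refl = reflects-true (trans (miss-high k (label k)) (≡ᵇ-refl (label k))) (ascents , descent)
    ... | no  k≢j  = reflects-false (trans (miss-high k (label j)) (≢⇒≡ᵇ≡false (label-≢ k≢j)))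
                                    λ (ascents′ , _) → <-asym descent (ascents′ j λ j≡k → k≢j (sym j≡k))
    miss-pattern {j = j} (_ , descent) last =
      reflects-false (trans (miss-last (label j)) (>⇒≡ᵇ≡false (s≤s (Finₚ.toℕ<n j))))
                     λ ascents → <-asym descent (ascents j)

    trunk-pattern : ∀ {p} P → (∀ k → Reflects (Ascent k p) (P (label k))) → ¬ AllAscents p →
                    (∀ k → ¬ Dip k p) → ViewPattern p (trunk n P)
    trunk-pattern P ascent⇔P _ _ (low k)  = subst (Reflects _) (sym (trunk-low k P)) (ascent⇔P k)
    trunk-pattern P _ _ _ mid             = reflects-true (trunk-mid P) tt
    trunk-pattern P _ _ ¬dip (high k)     = reflects-false (trunk-high k P) (¬dip k)
    trunk-pattern P _ ¬ascents _ last     = reflects-false (trunk-last P) ¬ascents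

    classify : ∀ p → CoordLt 0 n p →
               Σ (ℕ → Bool) λ f → ViewPattern p f × f (suc n) ≡ true × (∀ {σ} → σ ≐ f → 𝒞 n σ)
    classify p p₀<pₙ with all? (λ k → ascent? k p)
    ... | yes ascents = full n , full-pattern ascents , full-mid , c-full
    ... | no ¬ascents with any? (λ j → dip? j p)
    ...   | yes (j , dip) =
      miss n (label j) , miss-pattern dip , miss-mid (label j) , c-miss (label j) (inRange-label j)
    ...   | no ¬dip =
      trunk n P , trunk-pattern P (λ k → proof (ascent? k p)) ¬ascents (λ j dip → ¬dip (j , dip)) ,
      trunk-mid P , c-trunk P someAscent someNonAscent
      where
      P : ℕ → Bool
      P l = does (at p (pred l) <? at p l)
      someAscent : Σ ℕ λ l → (inRange n l ≡ true) × (P l ≡ true)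
      someAscent with ascent-exists n p p₀<pₙ
      ... | k , ascent = label k , inRange-label k , dec-true (ascent? k p) ascent
      someNonAscent : Σ ℕ λ l → (inRange n l ≡ true) × (P l ≡ false)
      someNonAscent with ¬∀⟶∃¬ n _ (λ k → ascent? k p) ¬ascents
      ... | k , ¬ascent = label k , inRange-label k , dec-false (ascent? k p) ¬ascent

    private
      toℕ<1+n : (k : Fin n) → toℕ k ℕ.< suc n
      toℕ<1+n k = ℕₚ.m<n⇒m<1+n (Finₚ.toℕ<n k)

      label<1+n : (k : Fin n) → label k ℕ.< suc n
      label<1+n k = s≤s (Finₚ.toℕ<n k)

    ascent-heights : ∀ g (k : Fin n) → g (toℕ k) ℕ.< g (label k) → Ascent k (heights (suc n) g)
    ascent-heights g k = CoordLt-heights g (toℕ<1+n k) (label<1+n k)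

    descent-heights : ∀ g (k : Fin n) → g (label k) ℕ.< g (toℕ k) →
                      CoordLt (label k) (toℕ k) (heights (suc n) g)
    descent-heights g k = CoordLt-heights g (label<1+n k) (toℕ<1+n k)

    first<last-heights : ∀ g → g 0 ℕ.< g n → CoordLt 0 n (heights (suc n) g)
    first<last-heights g = CoordLt-heights g (s≤s z≤n) ℕₚ.≤-refl

    count-pattern : ∀ P (k : Fin n) → Reflects (Ascent k (heights (suc n) (count P))) (P (label k))
    count-pattern P k with P (label k) in Pₖ
    ... | true  = ofʸ (ascent-heights (count P) k (count-ascent P (toℕ k) Pₖ))
    ... | false = ofⁿ (¬CoordLt-heights (count P) (toℕ<1+n k) (label<1+n k)
                                        (ℕₚ.≤-reflexive (count-flat P (toℕ k) Pₖ)))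

    realise : 2 ℕ.≤ n → ∀ {σ} (c : 𝒞 n σ) → indicator c (suc n) ≡ true →
              Σ (Point (suc n)) λ p → CoordLt 0 n p × ViewPattern p (indicator c)
    realise _ (c-empty _) ()
    realise _ (c-single j j∈[n+1] _) e with inRange⇒label {j = j} j∈[n+1]
    ... | _ , refl = contradictionᵇ e (single-mid (s≤s z≤n))
    realise _ (c-top _) e = contradictionᵇ e (top-below ℕₚ.≤-refl)
    realise 2≤n (c-full _) _ =
      heights (suc n) id , first<last-heights id (ℕₚ.≤-trans (s≤s z≤n) 2≤n) ,
      full-pattern λ k → ascent-heights id k ℕₚ.≤-refl
    realise 2≤n (c-miss j j∈[n] _) _ with inRange⇒label {j = j} j∈[n]
    ... | k , refl =
      heights (suc n) (dip (label k)) ,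
      first<last-heights (dip (label k)) (dip-first<last (s≤s z≤n) (Finₚ.toℕ<n k) 2≤n) ,
      miss-pattern ((λ k′ k′≢k → ascent-heights (dip (label k)) k′
                                   (dip-ascent (label k) (toℕ k′) (label-≢ k′≢k))) ,
                    descent-heights (dip (label k)) k (dip-descent (toℕ k)))
    realise _ (c-trunk P (k₁ , k₁∈[n] , Pk₁) (k₀ , k₀∈[n] , ¬Pk₀) _) _
      with inRange⇒label {j = k₁} k₁∈[n] | inRange⇒label {j = k₀} k₀∈[n]
    ... | k , refl | k′ , refl =
      heights (suc n) (count P) ,
      first<last-heights (count P)
        (ℕₚ.<-≤-trans (ℕₚ.≤-<-trans z≤n (count-ascent P (toℕ k) Pk₁)) (count-mono P (Finₚ.toℕ<n k))) ,
      trunk-pattern P (count-pattern P)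
        (λ ascents → contradictionᵇ (det (count-pattern P k′) (ofʸ (ascents k′))) ¬Pk₀)
        (λ j (_ , descent) → ¬CoordLt-heights (count P) (label<1+n j) (toℕ<1+n j) (count-step P (toℕ j)) descent)

    middleTrunk-convex : 2 ℕ.≤ n → (i : Fin (n ℕ.+ n ℕ.+ 2)) → label i ≡ suc n → IsConvexCode R (Tk n i)
    middleTrunk-convex 2≤n i i≡mid =
      convexCode-intro (CoordLt 0 n) W (CoordLt-convex 0 n) (CoordLt-open 0 n)
        (λ x → region-convex (labelView x)) (λ x → region-open (labelView x)) exhibit recognise
      where
      W : Fin (n ℕ.+ n ℕ.+ 2) → Point (suc n) → Set
      W x = region (labelView x)
      exhibit : ∀ {σ} → Tk n i σ → Σ (Point (suc n)) λ p → CoordLt 0 n p × Exhibits W p σ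
      exhibit {σ} (c , i∈σ) with realise 2≤n c (∈⇒true (indicator c) (indicator-≐ c) i≡mid i∈σ)
      ... | p , p₀<pₙ , shows =
        p , p₀<pₙ , pattern⇒exhibits {W = W} {σ = σ} {f = indicator c} (indicator-≐ c) (λ x → shows (labelView x))
      recognise : ∀ {σ p} → CoordLt 0 n p → Exhibits W p σ → Tk n i σ
      recognise {σ} {p} p₀<pₙ exhibits with classify p p₀<pₙ
      ... | f , shows , f[mid] , codeword = codeword σ≐f , true⇒∈ f i σ≐f i≡mid f[mid]
        where
        σ≐f : σ ≐ f
        σ≐f = exhibits⇒≐ {W = W} {σ = σ} {f = f} exhibits (λ x → shows (labelView x))

  module Trunks (n : ℕ) where
    open LabelValues n
    open MiddleTrunk n public using (middleTrunk-convex)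

    private
      M : ℕ
      M = n ℕ.+ n ℕ.+ 2

      indicator-at : ∀ {σ} (c : 𝒞 n σ) {i : Fin M} {l} → label i ≡ l → i ∈ σ → indicator c l ≡ true
      indicator-at c = ∈⇒true (indicator c) (indicator-≐ c)

    lowTrunk-convex : 2 ℕ.≤ n → (i : Fin M) (k : Fin n) → label i ≡ label k → IsConvexCode R (Tk n i)
    lowTrunk-convex 2≤n i k i≡k =
      convexCode-resp (λ ((c , _) , i∈σ) → c , i∈σ)
                      (λ (c , i∈σ) → (c , true⇒∈ (indicator c) midNeuron (indicator-≐ c) label-midNeuron
                                            (through-low⇒through-mid c k (indicator-at c i≡k i∈σ))) , i∈σ)
                      (convexCode-trunk i (middleTrunk-convex 2≤n midNeuron label-midNeuron))

    highTrunk-convex : (i : Fin M) (k : Fin n) → label i ≡ suc n ℕ.+ label k → IsConvexCode R (Tk n i)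
    highTrunk-convex i k i≡c =
      crossCode-convex (miss n (label k)) (top n) (suc n ℕ.+ label k) miss[c] (top-high k)
        (λ x → miss∩top k (labelView x))
        (λ (c , i∈σ) → through-high c k (indicator-at c i≡c i∈σ))
        (λ σ≐ → c-miss (label k) (inRange-label k) σ≐ , true⇒∈ (miss n (label k)) i σ≐ i≡c miss[c])
        (λ σ≐ → c-single (label k) (≤⇒inRange≡true (s≤s z≤n) (ℕₚ.m≤n⇒m≤1+n (Finₚ.toℕ<n k))) σ≐ ,
                true⇒∈ (single n (label k)) i σ≐ i≡c (≡ᵇ-refl (suc n ℕ.+ label k)))
        (λ σ≐ → c-top σ≐ , true⇒∈ (top n) i σ≐ i≡c (top-high k))
      where
      miss[c] : miss n (label k) (suc n ℕ.+ label k) ≡ true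
      miss[c] = trans (miss-high k (label k)) (≡ᵇ-refl (label k))

    lastTrunk-convex : (i : Fin M) → label i ≡ M → IsConvexCode R (Tk n i)
    lastTrunk-convex i i≡M =
      crossCode-convex (full n) (top n) (suc n ℕ.+ suc n) (at-c {full n} full-last) (at-c {top n} top-last)
        (λ x → full∩top (labelView x))
        (λ (c , i∈σ) → through-last c (indicator-at c i≡M i∈σ))
        (λ σ≐ → c-full σ≐ , true⇒∈ (full n) i σ≐ i≡c (at-c {full n} full-last))
        (λ σ≐ → c-single (suc n) (≤⇒inRange≡true (s≤s z≤n) (ℕₚ.≤-refl {suc n})) σ≐ ,
                true⇒∈ (single n (suc n)) i σ≐ i≡c (≡ᵇ-refl (suc n ℕ.+ suc n)))
        (λ σ≐ → c-top σ≐ , true⇒∈ (top n) i σ≐ i≡c (at-c {top n} top-last))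
      where
      i≡c : label i ≡ suc n ℕ.+ suc n
      i≡c = trans i≡M (n+n+2≡[1+n]+[1+n] n)
      at-c : ∀ {f} → f M ≡ true → f (suc n ℕ.+ suc n) ≡ true
      at-c {f} = subst (λ l → f l ≡ true) (n+n+2≡[1+n]+[1+n] n)

open import Data.Nat using (_≤_; _+_)

lemma4p4 : (R : RealField) (n : ℕ) → 2 ≤ n → (i : Fin (n + n + 2)) → IsConvexCode R (Tk n i)
lemma4p4 R n 2≤n i = byLabel (labelView i) refl
  where
  open Trunks R n
  byLabel : ∀ {l} → LabelView n l → label i ≡ l → IsConvexCode R (Tk n i)
  byLabel (low k)  i≡l = lowTrunk-convex 2≤n i k i≡l
  byLabel mid      i≡l = middleTrunk-convex 2≤n i i≡l
  byLabel (high k) i≡l = highTrunk-convex i k i≡l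
  byLabel last     i≡l = lastTrunk-convex i i≡l
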